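{- For every nonnegative integer $n$, let $LG_2(n)$ be the number of partitions of $n$ with no part equal to $1$ in which any two consecutive parts differ by at least $2$, and by at least $4$ if both are odd. Let $T(n)$ be the number of signed partitions of $n$ with $k$ positive parts, which are even and distinct, and $t$ negative parts, which are odd, distinct and each less than $2k$, such that the smallest positive part is greater than $2t+\delta_{1u}$, where $u$ is the smallest negative part (and $\delta_{1u}=1$ if $u=1$, $\delta_{1u}=0$ otherwise, including when there are no negative parts). Then $LG_2(n)=T(n)$ for all $n\ge 0$.
   Context: A partition of an integer $n$ is a finite nonincreasing sequence of positive integers (its parts) summing to $n$. A signed partition of an integer $n$ is a pair $(\pi,\nu)$ of ordinary partitions with $|\pi|-|\nu|=n$, where $|\cdot|$ denotes the sum of parts; the parts of $\pi$ are the positive parts and the parts of $\nu$ are the negative parts (their sizes). $\delta$ is the Kronecker delta. -}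

module Defs where

open import Data.Bool using (Bool; true; false; _∧_; _∨_; not; T; if_then_else_)
open import Data.Nat using (ℕ; zero; suc; _+_; _*_; _∸_; _≤ᵇ_; _<ᵇ_; _≡ᵇ_)
open import Data.List using (List; []; _∷_; length; last; map)
open import Data.Bool.ListAction using (and)
open import Data.Nat.ListAction using (sum)
open import Data.Maybe using (Maybe; just; nothing)
open import Data.Product using (Σ; _×_)
open import Relation.Binary.PropositionalEquality using (_≡_)

all : {A : Set} → (A → Bool) → List A → Bool
all p xs = and (map p xs)

isOdd : ℕ → Bool
isOdd zero = false
isOdd (suc n) = not (isOdd n)

isEven : ℕ → Bool
isEven n = not (isOdd n)

-- A partition is represented by the list of its parts, in nonincreasing order.
-- R holds for every pair of consecutive parts (a , b), a listed before b.
consecutive : (ℕ → ℕ → Bool) → List ℕ → Bool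
consecutive R [] = true
consecutive R (a ∷ []) = true
consecutive R (a ∷ b ∷ xs) = R a b ∧ consecutive R (b ∷ xs)

isPartition : List ℕ → Bool
isPartition xs = all (λ a → 1 ≤ᵇ a) xs ∧ consecutive (λ a b → b ≤ᵇ a) xs

isDistinctPartition : List ℕ → Bool
isDistinctPartition xs = all (λ a → 1 ≤ᵇ a) xs ∧ consecutive (λ a b → b <ᵇ a) xs

lgGap : ℕ → ℕ → Bool
lgGap a b = (2 + b ≤ᵇ a) ∧ (not (isOdd a ∧ isOdd b) ∨ (4 + b ≤ᵇ a))

isLG2 : List ℕ → Bool
isLG2 xs = isPartition xs ∧ all (λ a → not (a ≡ᵇ 1)) xs ∧ consecutive lgGap xs

LG2Set : ℕ → Set
LG2Set n = Σ (List ℕ) (λ xs → T (isLG2 xs) × sum xs ≡ n)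

delta1 : Maybe ℕ → ℕ
delta1 (just u) = if u ≡ᵇ 1 then 1 else 0
delta1 nothing = 0

smallestCond : List ℕ → List ℕ → Bool
smallestCond π ν with last π
... | nothing = true
... | just s = 2 * length ν + delta1 (last ν) <ᵇ s

isT : List ℕ → List ℕ → Bool
isT π ν =
  isDistinctPartition π ∧ all isEven π ∧
  isDistinctPartition ν ∧ all isOdd ν ∧ all (λ v → v <ᵇ 2 * length π) ν ∧
  smallestCond π ν

TSet : ℕ → Set
TSet n = Σ (List ℕ) (λ π → Σ (List ℕ) (λ ν → T (isT π ν) × sum π ≡ n + sum ν))

{-# OPTIONS --safe #-}
-- Write an LG₂ partition as a₁ > ⋯ > a_k, let b_i ∈ {0,1} be the parity of a_i and
-- o_i = b₁ + ⋯ + b_i.  It is sent to the positive parts p_i = a_i + 2o_{i−1} + b_i, which are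
-- even, and the negative parts ν = {2(k − i) + 1 : a_i odd}: an odd part a_i adds 1 to itself
-- and 2 to each of the k − i smaller parts, exactly the negative part 2(k − i) + 1, so
-- |π| − |ν| = |a|.  As p_i − p_{i+1} = a_i − a_{i+1} − b_i − b_{i+1}, the LG₂ gap condition says
-- exactly p_i − p_{i+1} ≥ 2, i.e. that the even p_i are distinct.  Appending a part a_{k+1} = 0
-- turns "no part 1" into one more gap condition, and its image is p_{k+1} = 2t, t the number of
-- negative parts, so it becomes p_k > 2t; as p_k is even this is the same as p_k > 2t + δ_{1u}.
-- Conversely the parities b_i are read off from ν, which is any set of odd numbers below 2k.
module Submission where

open import Defs
open import Data.Bool using (Bool; true; false; not; _∧_; _∨_; _xor_; T)
open import Data.Bool.Properties
  using (T-∧; T-≡; T-not-≡; T-irrelevant; not-¬; not-involutive; not-distribˡ-xor; xor-same; xor-assoc; xor-identityʳ; ∧-zeroʳ)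
open import Data.Empty using (⊥-elim)
open import Data.List using (List; []; _∷_; _∷ʳ_; length; last; map)
open import Data.List.Properties using (length-map)
open import Data.List.Relation.Unary.All as All using (All; []; _∷_)
open import Data.List.Relation.Unary.All.Properties using (all⁺; all⁻; ∷ʳ⁺)
open import Data.List.Relation.Unary.AllPairs as AllPairs using ()
open import Data.List.Relation.Unary.Linked as Linked using (Linked; []; [-]; _∷_)
open import Data.List.Relation.Unary.Linked.Properties using (++⁺; Linked⇒AllPairs)
open import Data.Maybe using (just; nothing)
open import Data.Maybe.Relation.Binary.Connected using (Connected; just; nothing-just; drop-just)
open import Data.Nat using (ℕ; zero; suc; _+_; _*_; _∸_; _≤_; _<_; _>_; z≤n; s≤s; s≤s⁻¹; _≤ᵇ_; _<ᵇ_; _≡ᵇ_; _≟_)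
open import Data.Nat.Properties
open import Data.Nat.ListAction using (sum)
open import Data.Nat.Tactic.RingSolver using (solve-∀)
open import Data.Product using (_×_; _,_; proj₁; proj₂)
open import Function using (_∘_; flip; _⇔_; mk⇔; Equivalence; _↔_; mk↔ₛ′)
open import Function.Properties.Equivalence using () renaming (trans to ⇔-trans)
open import Relation.Binary.Core using (Rel)
open import Relation.Binary.Definitions using (Transitive)
open import Relation.Binary.PropositionalEquality
open import Relation.Nullary using (yes; no)

open Equivalence using (to; from)

consecutive⇒Linked : ∀ {R : ℕ → ℕ → Bool} xs → T (consecutive R xs) → Linked (λ a b → T (R a b)) xs
consecutive⇒Linked []           _ = []
consecutive⇒Linked (a ∷ [])     _ = [-]
consecutive⇒Linked (a ∷ b ∷ xs) t =
  proj₁ (T-∧ .to t) ∷ consecutive⇒Linked (b ∷ xs) (proj₂ (T-∧ .to t))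

Linked⇒consecutive : ∀ {R : ℕ → ℕ → Bool} {xs} → Linked (λ a b → T (R a b)) xs → T (consecutive R xs)
Linked⇒consecutive []       = _
Linked⇒consecutive [-]      = _
Linked⇒consecutive (r ∷ rs) = T-∧ .from (r , Linked⇒consecutive rs)

module _ {a ℓ} {A : Set a} {R : Rel A ℓ} where

  Linked-∷ʳ⁻ : ∀ {xs y} → Linked R (xs ∷ʳ y) → Linked R xs × Connected R (last xs) (just y)
  Linked-∷ʳ⁻ {[]}          [-]       = [] , nothing-just
  Linked-∷ʳ⁻ {x ∷ []}      (r ∷ [-]) = [-] , just r
  Linked-∷ʳ⁻ {x ∷ x′ ∷ xs} (r ∷ rs) with Linked-∷ʳ⁻ {x′ ∷ xs} rs
  ... | rs′ , r′ = r ∷ rs′ , r′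

  Linked-∷ʳ⁺ : ∀ {xs y} → Linked R xs → Connected R (last xs) (just y) → Linked R (xs ∷ʳ y)
  Linked-∷ʳ⁺ rs r = ++⁺ rs r [-]

  Linked-∷ʳ⇒All : Transitive R → ∀ {xs y} → Linked R (xs ∷ʳ y) → All (λ x → R x y) xs
  Linked-∷ʳ⇒All trans {[]}          _        = []
  Linked-∷ʳ⇒All trans {x ∷ []}      (r ∷ _)  = r ∷ []
  Linked-∷ʳ⇒All trans {x ∷ x′ ∷ xs} {y} (r ∷ rs) with Linked-∷ʳ⇒All trans {x′ ∷ xs} {y} rs
  ... | r′ ∷ rs′ = trans r r′ ∷ r′ ∷ rs′

  All⇒Connected-last : ∀ {xs y} → All (λ x → R x y) xs → Connected R (last xs) (just y)
  All⇒Connected-last []               = nothing-just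
  All⇒Connected-last (r ∷ [])         = just r
  All⇒Connected-last (_ ∷ rs@(_ ∷ _)) = All⇒Connected-last rs

  Linked-head-All : Transitive R → ∀ {x xs} → Linked R (x ∷ xs) → All (R x) xs
  Linked-head-All trans = AllPairs.head ∘ Linked⇒AllPairs trans

  All⇒Linked-∷ : ∀ {x xs} → All (R x) xs → Linked R xs → Linked R (x ∷ xs)
  All⇒Linked-∷ []      _  = [-]
  All⇒Linked-∷ (r ∷ _) rs = r ∷ rs

Connected-just-map : ∀ {a ℓ₁ ℓ₂} {A : Set a} {R : Rel A ℓ₁} {S : Rel A ℓ₂} {mx y z} →
                     (∀ {x} → R x y → S x z) → Connected R mx (just y) → Connected S mx (just z)
Connected-just-map f (just r)     = just (f r)
Connected-just-map f nothing-just = nothing-just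

Even Odd : ℕ → Set
Even n = isOdd n ≡ false
Odd n = isOdd n ≡ true

bit : Bool → ℕ
bit false = 0
bit true  = 1

isOdd-+ : ∀ m n → isOdd (m + n) ≡ isOdd m xor isOdd n
isOdd-+ zero    n = refl
isOdd-+ (suc m) n = trans (cong not (isOdd-+ m n)) (not-distribˡ-xor (isOdd m) (isOdd n))

isOdd-2* : ∀ n → Even (2 * n)
isOdd-2* n = begin
  isOdd (n + (n + 0))  ≡⟨ cong (λ m → isOdd (n + m)) (+-identityʳ n) ⟩
  isOdd (n + n)        ≡⟨ isOdd-+ n n ⟩
  isOdd n xor isOdd n  ≡⟨ xor-same (isOdd n) ⟩
  false                ∎
  where open ≡-Reasoning

isOdd-1+2* : ∀ n → Odd (suc (2 * n))
isOdd-1+2* n = cong not (isOdd-2* n)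

isOdd-bit : ∀ b → isOdd (bit b) ≡ b
isOdd-bit false = refl
isOdd-bit true  = refl

Even≢Odd : ∀ {m n} → Even m → Odd n → m ≢ n
Even≢Odd em on refl = not-¬ (trans (sym em) on) refl

odd<even : ∀ {m} n → Odd m → m ≤ 2 * n → m < 2 * n
odd<even n om m≤2n = ≤∧≢⇒< m≤2n (λ eq → Even≢Odd (isOdd-2* n) om (sym eq))

1+2*<2*suc : ∀ n → suc (2 * n) < 2 * suc n
1+2*<2*suc n = subst (suc (2 * n) <_) (sym (*-suc 2 n)) ≤-refl

2*<2*suc : ∀ n → 2 * n < 2 * suc n
2*<2*suc n = <-trans (n<1+n (2 * n)) (1+2*<2*suc n)

infix 4 _≫_
_≫_ : ℕ → ℕ → Set
p ≫ q = 2 + q ≤ p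

≫-trans : Transitive _≫_
≫-trans {p} {q} {r} p≫q q≫r = ≤-trans q≫r (≤-trans (m≤n+m q 2) p≫q)

≫⇒> : ∀ {p q} → p ≫ q → p > q
≫⇒> = ≤-trans (n≤1+n _)

>⇒≫ : ∀ {p q} → Even p → Even q → p > q → p ≫ q
>⇒≫ ep eq q<p = ≤∧≢⇒< q<p (λ eq′ → Even≢Odd ep (cong not eq) (sym eq′))

Linked->⇒≫ : ∀ {xs} → All Even xs → Linked _>_ xs → Linked _≫_ xs
Linked->⇒≫ _                   []         = []
Linked->⇒≫ _                   [-]        = [-]
Linked->⇒≫ (ep ∷ eqs@(eq ∷ _)) (q<p ∷ rs) = >⇒≫ ep eq q<p ∷ Linked->⇒≫ eqs rs

LGGap : ℕ → ℕ → Set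
LGGap a c = T (lgGap a c)

LGGap⇒≫ : ∀ {a c b} → T ((2 + c ≤ᵇ a) ∧ b) → a ≫ c
LGGap⇒≫ {a} {c} g = ≤ᵇ⇒≤ (2 + c) a (proj₁ (T-∧ .to g))

≫-mixed-parity : ∀ {a c} x → isOdd a ≡ x → isOdd c ≡ not x → a ≫ c → 3 + c ≤ a
≫-mixed-parity {a} {c} x ea ec a≫c = ≤∧≢⇒< a≫c λ eq →
  not-¬ refl (trans (sym ea) (trans (cong isOdd (sym eq)) (trans (not-involutive (isOdd c)) ec)))

lgGap-cases : ∀ {a c} x y → isOdd a ≡ x → isOdd c ≡ y →
              T ((2 + c ≤ᵇ a) ∧ (not (x ∧ y) ∨ (4 + c ≤ᵇ a))) ⇔ a ≫ bit x + bit y + c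
lgGap-cases {a} {c} true  true  _  _  = mk⇔ (λ g → ≤ᵇ⇒≤ (4 + c) a (proj₂ (T-∧ .to g)))
                                            (λ h → T-∧ .from (≤⇒≤ᵇ (m+n≤o⇒n≤o 2 h) , ≤⇒≤ᵇ h))
lgGap-cases {a} {c} true  false ea ec = mk⇔ (≫-mixed-parity true ea ec ∘ LGGap⇒≫)
                                            (λ h → T-∧ .from (≤⇒≤ᵇ (m+n≤o⇒n≤o 1 h) , _))
lgGap-cases {a} {c} false true  ea ec = mk⇔ (≫-mixed-parity false ea ec ∘ LGGap⇒≫)
                                            (λ h → T-∧ .from (≤⇒≤ᵇ (m+n≤o⇒n≤o 1 h) , _))
lgGap-cases {a} {c} false false _  _  = mk⇔ LGGap⇒≫ (λ h → T-∧ .from (≤⇒≤ᵇ h , _))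

LGGap⇔ : ∀ a c → LGGap a c ⇔ a ≫ bit (isOdd a) + bit (isOdd c) + c
LGGap⇔ a c = lgGap-cases (isOdd a) (isOdd c) refl refl

≥1∧≢ᵇ1⇒≥2 : ∀ {a} → T (1 ≤ᵇ a) × T (not (a ≡ᵇ 1)) → 2 ≤ a
≥1∧≢ᵇ1⇒≥2 {suc (suc _)} _ = s≤s (s≤s z≤n)
≥1∧≢ᵇ1⇒≥2 {suc zero}    (_ , ())

≥2⇒≢ᵇ1 : ∀ {a} → 2 ≤ a → T (not (a ≡ᵇ 1))
≥2⇒≢ᵇ1 (s≤s (s≤s _)) = _

≥2⇒LGGap-0 : ∀ {a} → 2 ≤ a → LGGap a 0
≥2⇒LGGap-0 {a} h = T-∧ .from (≤⇒≤ᵇ h , subst (λ b → T (not b ∨ (4 ≤ᵇ a))) (sym (∧-zeroʳ (isOdd a))) _)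

T-isLG2 : ∀ xs → T (isLG2 xs) ⇔ Linked LGGap (xs ∷ʳ 0)
T-isLG2 xs = mk⇔ forward backward
  where
  forward : T (isLG2 xs) → Linked LGGap (xs ∷ʳ 0)
  forward t =
    let (partition , rest) = T-∧ .to t
        (positive , _)     = T-∧ .to partition
        (no1 , gaps)       = T-∧ .to rest
        ≥2                 = All.zipWith (λ {a} → ≥1∧≢ᵇ1⇒≥2 {a})
                               (all⁺ (1 ≤ᵇ_) xs positive , all⁺ (λ a → not (a ≡ᵇ 1)) xs no1)
    in Linked-∷ʳ⁺ (consecutive⇒Linked xs gaps) (All⇒Connected-last (All.map (λ {a} → ≥2⇒LGGap-0 {a}) ≥2))

  backward : Linked LGGap (xs ∷ʳ 0) → T (isLG2 xs)
  backward l =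
    let gaps = proj₁ (Linked-∷ʳ⁻ l)
        ≥2   = Linked-∷ʳ⇒All ≫-trans (Linked.map (λ {a} {c} → LGGap⇒≫ {a} {c}) l)
    in T-∧ .from ( T-∧ .from ( all⁻ (1 ≤ᵇ_) (All.map (≤⇒≤ᵇ ∘ ≤-trans (s≤s z≤n)) ≥2)
                             , Linked⇒consecutive (Linked.map (λ {a} {c} → ≤⇒≤ᵇ ∘ ≤-trans (m≤n+m c 2) ∘ LGGap⇒≫ {a} {c}) gaps))
                 , T-∧ .from (all⁻ (λ a → not (a ≡ᵇ 1)) (All.map ≥2⇒≢ᵇ1 ≥2) , Linked⇒consecutive gaps))

shift : ℕ → Bool → ℕ
shift o b = 2 * o + bit b

isOdd-+shift : ∀ a o b → isOdd (a + shift o b) ≡ isOdd a xor b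
isOdd-+shift a o b = begin
  isOdd (a + shift o b)                         ≡⟨ isOdd-+ a (shift o b) ⟩
  isOdd a xor isOdd (2 * o + bit b)             ≡⟨ cong (isOdd a xor_) (isOdd-+ (2 * o) (bit b)) ⟩
  isOdd a xor (isOdd (2 * o) xor isOdd (bit b)) ≡⟨ cong₂ (λ x y → isOdd a xor (x xor y)) (isOdd-2* o) (isOdd-bit b) ⟩
  isOdd a xor b                                 ∎
  where open ≡-Reasoning

isOdd-∸shift : ∀ {p} o b → Even p → shift o b ≤ p → isOdd (p ∸ shift o b) ≡ b
isOdd-∸shift {p} o b ep le = begin
  isOdd a                      ≡⟨ sym (xor-identityʳ (isOdd a)) ⟩
  isOdd a xor false            ≡⟨ cong (isOdd a xor_) (sym (xor-same b)) ⟩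
  isOdd a xor (b xor b)        ≡⟨ sym (xor-assoc (isOdd a) b b) ⟩
  (isOdd a xor b) xor b        ≡⟨ cong (_xor b) (sym (isOdd-+shift a o b)) ⟩
  isOdd (a + shift o b) xor b  ≡⟨ cong (λ m → isOdd m xor b) (m∸n+n≡m le) ⟩
  isOdd p xor b                ≡⟨ cong (_xor b) ep ⟩
  b                            ∎
  where
  open ≡-Reasoning
  a = p ∸ shift o b

≫-shift : ∀ a c o x y → a ≫ x + y + c ⇔ a + (2 * o + x) ≫ c + (2 * (o + x) + y)
≫-shift a c o x y = mk⇔
  (λ h → subst (_≤ a + (2 * o + x)) (rearrange a c o x y) (+-monoˡ-≤ (2 * o + x) h))
  (λ h → +-cancelʳ-≤ (2 * o + x) _ a (subst (_≤ a + (2 * o + x)) (sym (rearrange a c o x y)) h))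
  where
  rearrange : ∀ a c o x y → 2 + (x + y + c) + (2 * o + x) ≡ 2 + (c + (2 * (o + x) + y))
  rearrange = solve-∀

LGGap⇔shifted : ∀ o a c → LGGap a c ⇔ a + shift o (isOdd a) ≫ c + shift (o + bit (isOdd a)) (isOdd c)
LGGap⇔shifted o a c = ⇔-trans (LGGap⇔ a c) (≫-shift a c o (bit (isOdd a)) (bit (isOdd c)))

parities : List ℕ → List Bool
parities = map isOdd

ones : List Bool → ℕ
ones bs = sum (map bit bs)

oddPositions : List Bool → List ℕ
oddPositions []           = []
oddPositions (true ∷ bs)  = suc (2 * length bs) ∷ oddPositions bs
oddPositions (false ∷ bs) = oddPositions bs

length-oddPositions : ∀ bs → length (oddPositions bs) ≡ ones bs
length-oddPositions []           = refl
length-oddPositions (true ∷ bs)  = cong suc (length-oddPositions bs)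
length-oddPositions (false ∷ bs) = length-oddPositions bs

sum-oddPositions-∷ : ∀ b bs → sum (oddPositions (b ∷ bs)) ≡ bit b * suc (2 * length bs) + sum (oddPositions bs)
sum-oddPositions-∷ true  bs = cong (_+ sum (oddPositions bs)) (sym (*-identityˡ _))
sum-oddPositions-∷ false bs = refl

-- o counts the odd parts already passed, each of which adds 2 to every later part.
raise : ℕ → List Bool → List ℕ → List ℕ
raise o (b ∷ bs) (a ∷ as) = a + shift o b ∷ raise (o + bit b) bs as
raise o _        _        = []

lower : ℕ → List Bool → List ℕ → List ℕ
lower o (b ∷ bs) (p ∷ ps) = p ∸ shift o b ∷ lower (o + bit b) bs ps
lower o _        _        = []

length-raise : ∀ o xs → length (raise o (parities xs) xs) ≡ length (parities xs)
length-raise o []       = refl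
length-raise o (a ∷ xs) = cong suc (length-raise _ xs)

raise-even : ∀ o xs → All Even (raise o (parities xs) xs)
raise-even o []       = []
raise-even o (a ∷ xs) = trans (isOdd-+shift a o (isOdd a)) (xor-same (isOdd a)) ∷ raise-even _ xs

raise-Linked⁺ : ∀ o ys → Linked LGGap ys → Linked _≫_ (raise o (parities ys) ys)
raise-Linked⁺ o []           []       = []
raise-Linked⁺ o (a ∷ [])     [-]      = [-]
raise-Linked⁺ o (a ∷ c ∷ zs) (g ∷ gs) = LGGap⇔shifted o a c .to g ∷ raise-Linked⁺ _ (c ∷ zs) gs

raise-Linked⁻ : ∀ o ys → Linked _≫_ (raise o (parities ys) ys) → Linked LGGap ys
raise-Linked⁻ o []           []       = []
raise-Linked⁻ o (a ∷ [])     [-]      = [-]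
raise-Linked⁻ o (a ∷ c ∷ zs) (g ∷ gs) = LGGap⇔shifted o a c .from g ∷ raise-Linked⁻ _ (c ∷ zs) gs

raise-∷ʳ0 : ∀ o xs → raise o (parities (xs ∷ʳ 0)) (xs ∷ʳ 0) ≡ raise o (parities xs) xs ∷ʳ 2 * (o + ones (parities xs))
raise-∷ʳ0 o []       = cong (_∷ []) (trans (+-identityʳ (2 * o)) (cong (2 *_) (sym (+-identityʳ o))))
raise-∷ʳ0 o (a ∷ xs) = cong (a + shift o (isOdd a) ∷_) (begin
  raise o′ (parities (xs ∷ʳ 0)) (xs ∷ʳ 0)                         ≡⟨ raise-∷ʳ0 o′ xs ⟩
  raise o′ (parities xs) xs ∷ʳ 2 * (o′ + ones (parities xs))        ≡⟨ cong (λ m → raise o′ (parities xs) xs ∷ʳ 2 * m) (+-assoc o _ _) ⟩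
  raise o′ (parities xs) xs ∷ʳ 2 * (o + ones (parities (a ∷ xs)))  ∎)
  where
  open ≡-Reasoning
  o′ = o + bit (isOdd a)

sum-raise : ∀ o xs → sum (raise o (parities xs) xs) ≡ sum xs + (2 * o * length xs + sum (oddPositions (parities xs)))
sum-raise o []       = cong (_+ 0) (sym (*-zeroʳ (2 * o)))
sum-raise o (a ∷ xs) = begin
  a + shift o b + sum (raise (o + x) (parities xs) xs)
    ≡⟨ cong (a + shift o b +_) (sum-raise (o + x) xs) ⟩
  a + (2 * o + x) + (sum xs + (2 * (o + x) * length xs + V))
    ≡⟨ regroup a (sum xs) o x (length xs) V ⟩
  a + sum xs + (2 * o * suc (length xs) + (x * suc (2 * length xs) + V))
    ≡⟨ cong (λ L → a + sum xs + (2 * o * suc (length xs) + (x * suc (2 * L) + V))) (sym (length-map isOdd xs)) ⟩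
  a + sum xs + (2 * o * suc (length xs) + (x * suc (2 * length (parities xs)) + V))
    ≡⟨ cong (λ W → a + sum xs + (2 * o * suc (length xs) + W)) (sym (sum-oddPositions-∷ b (parities xs))) ⟩
  a + sum xs + (2 * o * suc (length xs) + sum (oddPositions (parities (a ∷ xs))))
    ∎
  where
  open ≡-Reasoning
  b = isOdd a
  x = bit b
  V = sum (oddPositions (parities xs))
  regroup : ∀ a S o x L V → a + (2 * o + x) + (S + (2 * (o + x) * L + V)) ≡ a + S + (2 * o * suc L + (x * suc (2 * L) + V))
  regroup = solve-∀

lower-raise : ∀ o xs → lower o (parities xs) (raise o (parities xs) xs) ≡ xs
lower-raise o []       = refl
lower-raise o (a ∷ xs) = cong₂ _∷_ (m+n∸n≡m a (shift o (isOdd a))) (lower-raise _ xs)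

shift≤ : ∀ o b n {p} → 2 * (o + (bit b + n)) < p → shift o b ≤ p
shift≤ o b n lt = ≤-trans (m≤m+n (shift o b) (bit b + 2 * n)) (≤-trans (≤-reflexive (expand o (bit b) n)) (<⇒≤ lt))
  where
  expand : ∀ o x n → 2 * o + x + (x + 2 * n) ≡ 2 * (o + (x + n))
  expand = solve-∀

ones-∷-bound : ∀ o b bs {ps} → All (2 * (o + ones (b ∷ bs)) <_) ps → All (2 * (o + bit b + ones bs) <_) ps
ones-∷-bound o b bs {ps} = subst (λ m → All (2 * m <_) ps) (sym (+-assoc o (bit b) (ones bs)))

raise-lower : ∀ o bs ps → length bs ≡ length ps → All (2 * (o + ones bs) <_) ps → raise o bs (lower o bs ps) ≡ ps
raise-lower o []       []       _   _          = refl
raise-lower o (b ∷ bs) (p ∷ ps) len (p> ∷ ps>) =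
  cong₂ _∷_ (m∸n+n≡m (shift≤ o b (ones bs) p>)) (raise-lower _ bs ps (suc-injective len) (ones-∷-bound o b bs ps>))

parities-lower : ∀ o bs ps → length bs ≡ length ps → All Even ps → All (2 * (o + ones bs) <_) ps →
                 parities (lower o bs ps) ≡ bs
parities-lower o []       []       _   _          _          = refl
parities-lower o (b ∷ bs) (p ∷ ps) len (ep ∷ eps) (p> ∷ ps>) =
  cong₂ _∷_ (isOdd-∸shift o b ep (shift≤ o b (ones bs) p>))
            (parities-lower _ bs ps (suc-injective len) eps (ones-∷-bound o b bs ps>))

DistinctOddsBelow : ℕ → List ℕ → Set
DistinctOddsBelow m ν = Linked _>_ ν × All Odd ν × All (_< m) ν

oddPositions-distinctOdds : ∀ bs → DistinctOddsBelow (2 * length bs) (oddPositions bs)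
oddPositions-distinctOdds []           = [] , [] , []
oddPositions-distinctOdds (true ∷ bs)  with oddPositions-distinctOdds bs
... | dec , odd , below = All⇒Linked-∷ (All.map m<n⇒m<1+n below) dec
                        , isOdd-1+2* (length bs) ∷ odd
                        , 1+2*<2*suc (length bs) ∷ All.map (λ v< → <-trans v< (2*<2*suc (length bs))) below
oddPositions-distinctOdds (false ∷ bs) with oddPositions-distinctOdds bs
... | dec , odd , below = dec , odd , All.map (λ v< → <-trans v< (2*<2*suc (length bs))) below

decode : ℕ → List ℕ → List Bool
decode zero    ν       = []
decode (suc k) []      = false ∷ decode k []
decode (suc k) (v ∷ ν) with v ≟ suc (2 * k)
... | yes _ = true ∷ decode k ν
... | no _  = false ∷ decode k (v ∷ ν)

length-decode : ∀ k ν → length (decode k ν) ≡ k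
length-decode zero    ν       = refl
length-decode (suc k) []      = cong suc (length-decode k [])
length-decode (suc k) (v ∷ ν) with v ≟ suc (2 * k)
... | yes _ = cong suc (length-decode k ν)
... | no _  = cong suc (length-decode k (v ∷ ν))

decode-hit : ∀ k ν → decode (suc k) (suc (2 * k) ∷ ν) ≡ true ∷ decode k ν
decode-hit k ν with suc (2 * k) ≟ suc (2 * k)
... | yes _ = refl
... | no ne = ⊥-elim (ne refl)

decode-miss : ∀ k ν → All (_< 2 * k) ν → decode (suc k) ν ≡ false ∷ decode k ν
decode-miss k []      _        = refl
decode-miss k (v ∷ ν) (v< ∷ _) with v ≟ suc (2 * k)
... | yes refl = ⊥-elim (1+n≰n (<⇒≤ v<))
... | no _     = refl

decode-oddPositions : ∀ bs → decode (length bs) (oddPositions bs) ≡ bs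
decode-oddPositions []           = refl
decode-oddPositions (true ∷ bs)  = trans (decode-hit (length bs) _) (cong (true ∷_) (decode-oddPositions bs))
decode-oddPositions (false ∷ bs) =
  trans (decode-miss (length bs) _ (proj₂ (proj₂ (oddPositions-distinctOdds bs)))) (cong (false ∷_) (decode-oddPositions bs))

oddPositions-decode : ∀ k ν → DistinctOddsBelow (2 * k) ν → oddPositions (decode k ν) ≡ ν
oddPositions-decode zero    []      _                = refl
oddPositions-decode zero    (v ∷ ν) (_ , _ , () ∷ _)
oddPositions-decode (suc k) []      _                = oddPositions-decode k [] ([] , [] , [])
oddPositions-decode (suc k) (v ∷ ν) (dec , ov ∷ odd , v< ∷ _) with v ≟ suc (2 * k)
... | yes refl = cong₂ _∷_ (cong (suc ∘ (2 *_)) (length-decode k ν))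
                           (oddPositions-decode k ν (Linked.tail dec , odd , All.zipWith {P = Odd} below-2k (odd , below-v)))
  where
  below-v = Linked-head-All (flip <-trans) dec
  below-2k : ∀ {w} → Odd w × w < suc (2 * k) → w < 2 * k
  below-2k (ow , w<) = odd<even k ow (s≤s⁻¹ w<)
... | no v≢    = oddPositions-decode k (v ∷ ν) (dec , ov ∷ odd , v<2k ∷ All.map (λ w< → <-trans w< v<2k) below-v)
  where
  below-v = Linked-head-All (flip <-trans) dec
  v<2k : v < 2 * k
  v<2k = odd<even k ov (s≤s⁻¹ (≤∧≢⇒< (s≤s⁻¹ (subst (v <_) (*-suc 2 k) v<)) v≢))

delta1≤1 : ∀ m → delta1 m ≤ 1
delta1≤1 nothing  = z≤n
delta1≤1 (just u) with u ≡ᵇ 1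
... | true  = ≤-refl
... | false = z≤n

T-smallestCond : ∀ π ν → T (smallestCond π ν) ⇔ Connected _>_ (last π) (just (2 * length ν + delta1 (last ν)))
T-smallestCond π ν with last π
... | nothing = mk⇔ (λ _ → nothing-just) _
... | just s  = mk⇔ (just ∘ <ᵇ⇒< _ s) (<⇒<ᵇ ∘ drop-just)

odd⇒≥ᵇ1 : ∀ {v} → Odd v → T (1 ≤ᵇ v)
odd⇒≥ᵇ1 {suc _} _ = _

IsT : List ℕ → List ℕ → Set
IsT π ν = All Even π × Linked _≫_ (π ∷ʳ 2 * length ν) × DistinctOddsBelow (2 * length π) ν

T-isT : ∀ π ν → T (isT π ν) ⇔ IsT π ν
T-isT π ν = mk⇔ forward backward
  where
  t = length ν

  forward : T (isT π ν) → IsT π ν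
  forward t₀ =
    let (πdistinct , t₁) = T-∧ {isDistinctPartition π} .to t₀
        (πeven , t₂)     = T-∧ {all isEven π} .to t₁
        (νdistinct , t₃) = T-∧ {isDistinctPartition ν} .to t₂
        (νodd , t₄)      = T-∧ {all isOdd ν} .to t₃
        (νbelow , sc)    = T-∧ {all (λ v → v <ᵇ 2 * length π) ν} .to t₄
        evens            = All.map (T-not-≡ .to) (all⁺ isEven π πeven)
        πdec             = consecutive⇒Linked π (proj₂ (T-∧ {all (1 ≤ᵇ_) π} .to πdistinct))
        last>2t          = Connected-just-map (≤-<-trans (m≤m+n (2 * t) _)) (T-smallestCond π ν .to sc)
    in evens
     , Linked->⇒≫ (∷ʳ⁺ evens (isOdd-2* t)) (Linked-∷ʳ⁺ (Linked.map (λ {p} {q} → <ᵇ⇒< q p) πdec) last>2t)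
     , Linked.map (λ {u} {v} → <ᵇ⇒< v u) (consecutive⇒Linked ν (proj₂ (T-∧ {all (1 ≤ᵇ_) ν} .to νdistinct)))
     , All.map (T-≡ .to) (all⁺ isOdd ν νodd)
     , All.map (λ {v} → <ᵇ⇒< v _) (all⁺ (λ v → v <ᵇ 2 * length π) ν νbelow)

  backward : IsT π ν → T (isT π ν)
  backward (evens , chain , νdec , odds , below) =
    let (πchain , last≫2t) = Linked-∷ʳ⁻ chain
        ≫2t                = Linked-∷ʳ⇒All ≫-trans chain
        above2t+δ : ∀ {p} → p ≫ 2 * t → 2 * t + delta1 (last ν) < p
        above2t+δ = ≤-trans (s≤s (≤-trans (+-monoʳ-≤ (2 * t) (delta1≤1 (last ν))) (≤-reflexive (+-comm (2 * t) 1))))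
    in T-∧ .from ( T-∧ .from ( all⁻ (1 ≤ᵇ_) (All.map (≤⇒≤ᵇ ∘ ≤-trans (s≤s z≤n)) ≫2t)
                             , Linked⇒consecutive (Linked.map (<⇒<ᵇ ∘ ≫⇒>) πchain))
     , T-∧ .from ( all⁻ isEven (All.map (T-not-≡ .from) evens)
     , T-∧ .from ( T-∧ .from ( all⁻ (1 ≤ᵇ_) (All.map (λ {v} → odd⇒≥ᵇ1 {v}) odds)
                             , Linked⇒consecutive (Linked.map <⇒<ᵇ νdec))
     , T-∧ .from ( all⁻ isOdd (All.map (T-≡ .from) odds)
     , T-∧ .from ( all⁻ (λ v → v <ᵇ 2 * length π) (All.map <⇒<ᵇ below)
                 , T-smallestCond π ν .from (Connected-just-map above2t+δ last≫2t))))))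

positiveParts : List ℕ → List ℕ
positiveParts xs = raise 0 (parities xs) xs

negativeParts : List ℕ → List ℕ
negativeParts xs = oddPositions (parities xs)

fromSigned : List ℕ → List ℕ → List ℕ
fromSigned π ν = lower 0 (decode (length π) ν) π

Linked-LGGap⇔Linked-≫ : ∀ xs → Linked LGGap (xs ∷ʳ 0) ⇔ Linked _≫_ (positiveParts xs ∷ʳ 2 * length (negativeParts xs))
Linked-LGGap⇔Linked-≫ xs = mk⇔ (subst (Linked _≫_) appended ∘ raise-Linked⁺ 0 (xs ∷ʳ 0))
                                (raise-Linked⁻ 0 (xs ∷ʳ 0) ∘ subst (Linked _≫_) (sym appended))
  where
  appended : raise 0 (parities (xs ∷ʳ 0)) (xs ∷ʳ 0) ≡ positiveParts xs ∷ʳ 2 * length (negativeParts xs)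
  appended = trans (raise-∷ʳ0 0 xs) (cong (λ m → positiveParts xs ∷ʳ 2 * m) (sym (length-oddPositions (parities xs))))

isT-signed : ∀ xs → T (isLG2 xs) → T (isT (positiveParts xs) (negativeParts xs))
isT-signed xs lg = T-isT _ _ .from
  ( raise-even 0 xs
  , Linked-LGGap⇔Linked-≫ xs .to (T-isLG2 xs .to lg)
  , subst (λ k → DistinctOddsBelow (2 * k) (negativeParts xs)) (sym (length-raise 0 xs))
          (oddPositions-distinctOdds (parities xs)))

sum-signed : ∀ xs → sum (positiveParts xs) ≡ sum xs + sum (negativeParts xs)
sum-signed = sum-raise 0

fromSigned-signed : ∀ xs → fromSigned (positiveParts xs) (negativeParts xs) ≡ xs
fromSigned-signed xs = trans (cong (λ bs → lower 0 bs (positiveParts xs)) decoded) (lower-raise 0 xs)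
  where
  decoded : decode (length (positiveParts xs)) (negativeParts xs) ≡ parities xs
  decoded = trans (cong (λ k → decode k (negativeParts xs)) (length-raise 0 xs)) (decode-oddPositions (parities xs))

module _ (π ν : List ℕ) (valid : T (isT π ν)) where

  private
    bs = decode (length π) ν
    signed = T-isT π ν .to valid
    chain = proj₁ (proj₂ signed)

    ν-decoded : oddPositions bs ≡ ν
    ν-decoded = oddPositions-decode (length π) ν (proj₂ (proj₂ signed))

    above : All (2 * (0 + ones bs) <_) π
    above = subst (λ m → All (2 * m <_) π) (trans (cong length (sym ν-decoded)) (length-oddPositions bs))
                  (All.map ≫⇒> (Linked-∷ʳ⇒All ≫-trans chain))

    parities-fromSigned : parities (fromSigned π ν) ≡ bs
    parities-fromSigned = parities-lower 0 bs π (length-decode _ ν) (proj₁ signed) above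

  positiveParts-fromSigned : positiveParts (fromSigned π ν) ≡ π
  positiveParts-fromSigned = trans (cong (λ bs′ → raise 0 bs′ (fromSigned π ν)) parities-fromSigned)
                                   (raise-lower 0 bs π (length-decode _ ν) above)

  negativeParts-fromSigned : negativeParts (fromSigned π ν) ≡ ν
  negativeParts-fromSigned = trans (cong oddPositions parities-fromSigned) ν-decoded

  isLG2-fromSigned : T (isLG2 (fromSigned π ν))
  isLG2-fromSigned = T-isLG2 _ .from (Linked-LGGap⇔Linked-≫ _ .from
    (subst₂ (λ π′ ν′ → Linked _≫_ (π′ ∷ʳ 2 * length ν′)) (sym positiveParts-fromSigned) (sym negativeParts-fromSigned) chain))

  sum-fromSigned : ∀ {n} → sum π ≡ n + sum ν → sum (fromSigned π ν) ≡ n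
  sum-fromSigned {n} s = +-cancelʳ-≡ (sum ν) _ n (begin
    sum xs + sum ν                  ≡⟨ cong (λ ν′ → sum xs + sum ν′) negativeParts-fromSigned ⟨
    sum xs + sum (negativeParts xs) ≡⟨ sum-signed xs ⟨
    sum (positiveParts xs)          ≡⟨ cong sum positiveParts-fromSigned ⟩
    sum π                           ≡⟨ s ⟩
    n + sum ν                       ∎)
    where
    open ≡-Reasoning
    xs = fromSigned π ν

module _ {n : ℕ} where

  LG2Set-≡ : {x y : LG2Set n} → proj₁ x ≡ proj₁ y → x ≡ y
  LG2Set-≡ {xs , t , s} {.xs , t′ , s′} refl = cong₂ (λ t s → xs , t , s) (T-irrelevant t t′) (≡-irrelevant s s′)

  TSet-≡ : {x y : TSet n} → proj₁ x ≡ proj₁ y → proj₁ (proj₂ x) ≡ proj₁ (proj₂ y) → x ≡ y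
  TSet-≡ {π , ν , t , s} {.π , .ν , t′ , s′} refl refl = cong₂ (λ t s → π , ν , t , s) (T-irrelevant t t′) (≡-irrelevant s s′)

theorem5p2 : (n : ℕ) → LG2Set n ↔ TSet n
theorem5p2 n = mk↔ₛ′ toT fromT toT∘fromT fromT∘toT
  where
  toT : LG2Set n → TSet n
  toT (xs , lg , s) =
    positiveParts xs , negativeParts xs , isT-signed xs lg , subst (λ m → _ ≡ m + _) s (sum-signed xs)

  fromT : TSet n → LG2Set n
  fromT (π , ν , t , s) = fromSigned π ν , isLG2-fromSigned π ν t , sum-fromSigned π ν t s

  toT∘fromT : ∀ y → toT (fromT y) ≡ y
  toT∘fromT (π , ν , t , _) = TSet-≡ (positiveParts-fromSigned π ν t) (negativeParts-fromSigned π ν t)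

  fromT∘toT : ∀ x → fromT (toT x) ≡ x
  fromT∘toT (xs , _ , _) = LG2Set-≡ (fromSigned-signed xs)
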